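{- Let $G=(V,E,w)$ be a vertex-weighted directed graph and let $G'$ be the undirected graph with vertex set $V_{\mathrm{out}}\cup V_{\mathrm{in}}$ (two disjoint copies $\{v_{\mathrm{out}}:v\in V\}$ and $\{v_{\mathrm{in}}:v\in V\}$ of $V$) whose edges are: a clique on $V_{\mathrm{out}}$, a clique on $V_{\mathrm{in}}$, the edges $\{v_{\mathrm{out}},v_{\mathrm{in}}\}$ for $v\in V$, and the edges $\{u_{\mathrm{out}},v_{\mathrm{in}}\}$ for $(u,v)\in E$. Then for every vertex cut $(L',S',R')$ of $G'$, either $L'\subseteq V_{\mathrm{out}}$ and $R'\subseteq V_{\mathrm{in}}$, or $L'\subseteq V_{\mathrm{in}}$ and $R'\subseteq V_{\mathrm{out}}$.
   Context: A vertex cut of an undirected graph is a tripartition $(L,S,R)$ of its vertex set with $L$ and $R$ nonempty and no edge between a vertex of $L$ and a vertex of $R$. -}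

module Defs where

open import Data.Nat using (ℕ)
open import Data.Fin using (Fin)
open import Data.Sum using (_⊎_; inj₁; inj₂)
open import Data.Product using (∃; _×_)
open import Relation.Binary.PropositionalEquality using (_≡_)
open import Relation.Nullary using (¬_)
open import Data.Unit using (⊤)
open import Data.Empty using (⊥)

-- An undirected graph on vertex type X, given by its (symmetric) adjacency relation.
-- A vertex cut (L , S , R) of such a graph, encoded as a labelling of every vertex
-- by which block of the tripartition it lies in.
data Part : Set where
  L S R : Part

record IsVertexCut {X : Set} (Adj : X → X → Set) (part : X → Part) : Set where
  field
    L-nonempty : ∃ λ x → part x ≡ L
    R-nonempty : ∃ λ x → part x ≡ R
    no-L-R-edge : ∀ x y → part x ≡ L → part y ≡ R → ¬ Adj x y

-- Vertices of G' : inj₁ v = v_out , inj₂ v = v_in.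
Vertex′ : ℕ → Set
Vertex′ n = Fin n ⊎ Fin n

data Adj′ {n : ℕ} (E : Fin n → Fin n → Set) : Vertex′ n → Vertex′ n → Set where
  out-clique : ∀ {u v} → ¬ u ≡ v → Adj′ E (inj₁ u) (inj₁ v)
  in-clique  : ∀ {u v} → ¬ u ≡ v → Adj′ E (inj₂ u) (inj₂ v)
  out-in     : ∀ {v} → Adj′ E (inj₁ v) (inj₂ v)
  in-out     : ∀ {v} → Adj′ E (inj₂ v) (inj₁ v)
  arc-out-in : ∀ {u v} → E u v → Adj′ E (inj₁ u) (inj₂ v)
  arc-in-out : ∀ {u v} → E u v → Adj′ E (inj₂ v) (inj₁ u)

IsOut IsIn : ∀ {n} → Vertex′ n → Set
IsOut (inj₁ _) = ⊤
IsOut (inj₂ _) = ⊥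
IsIn (inj₁ _) = ⊥
IsIn (inj₂ _) = ⊤

{-# OPTIONS --safe #-}
module Submission where

-- V_out and V_in are cliques of G′, and a clique never meets both L and R: two
-- distinct vertices would form an L–R edge, and a single vertex lies in one block.
-- As L and R are nonempty, one copy of V meets L and the other meets R, and the
-- clique property of each copy then keeps the other side out of it.

open import Defs
open import Data.Nat using (ℕ)
open import Data.Fin using (Fin)
open import Data.Sum using (_⊎_; inj₁; inj₂)
open import Data.Product using (_×_; _,_)
open import Data.Empty using (⊥; ⊥-elim)
open import Data.Unit using (tt)
open import Relation.Binary.PropositionalEquality using (_≡_; _≢_; refl; trans; sym)

Clique : {A X : Set} → (X → X → Set) → (A → X) → Set
Clique Adj f = ∀ {a b} → a ≢ b → Adj (f a) (f b)

L≢R : L ≢ R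
L≢R ()

module _ {X : Set} {Adj : X → X → Set} {part : X → Part}
         (cut : IsVertexCut Adj part) where
  open IsVertexCut cut

  clique-not-across-cut : {A : Set} {f : A → X} → Clique Adj f →
    ∀ {a b} → part (f a) ≡ L → part (f b) ≡ R → ⊥
  clique-not-across-cut {f = f} clique {a} {b} aL bR =
    no-L-R-edge (f a) (f b) aL bR (clique λ { refl → L≢R (trans (sym aL) bR) })

module _ {n : ℕ} {E : Fin n → Fin n → Set} {part : Vertex′ n → Part}
         (cut : IsVertexCut (Adj′ E) part) where

  out-not-across-cut : ∀ {u v} → part (inj₁ u) ≡ L → part (inj₁ v) ≡ R → ⊥
  out-not-across-cut = clique-not-across-cut cut out-clique

  in-not-across-cut : ∀ {u v} → part (inj₂ u) ≡ L → part (inj₂ v) ≡ R → ⊥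
  in-not-across-cut = clique-not-across-cut cut in-clique

proposition3p2 : (n : ℕ) (E : Fin n → Fin n → Set) (w : Fin n → ℕ)
    → (part : Vertex′ n → Part) → IsVertexCut (Adj′ E) part
    → ((∀ x → part x ≡ L → IsOut x) × (∀ x → part x ≡ R → IsIn x))
      ⊎ ((∀ x → part x ≡ L → IsIn x) × (∀ x → part x ≡ R → IsOut x))
proposition3p2 n E _ part cut with IsVertexCut.L-nonempty cut | IsVertexCut.R-nonempty cut
... | inj₁ _ , uL | inj₁ _ , vR = ⊥-elim (out-not-across-cut cut uL vR)
... | inj₂ _ , uL | inj₂ _ , vR = ⊥-elim (in-not-across-cut cut uL vR)
... | inj₁ _ , uL | inj₂ _ , vR =
  inj₁ ( (λ { (inj₁ _) _ → tt ; (inj₂ _) xL → in-not-across-cut cut xL vR })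
       , (λ { (inj₁ _) xR → out-not-across-cut cut uL xR ; (inj₂ _) _ → tt }) )
... | inj₂ _ , uL | inj₁ _ , vR =
  inj₂ ( (λ { (inj₁ _) xL → out-not-across-cut cut xL vR ; (inj₂ _) _ → tt })
       , (λ { (inj₁ _) _ → tt ; (inj₂ _) xR → in-not-across-cut cut uL xR }) )
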